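{- For every $S\in\mathcal{R}_\pi^\times$, \[x_S=\sum_{\substack{U,T\in\mathcal{R}_\pi^\times\\ U\subseteq T\supseteq S}}(-1)^{|T|+|S|+|U|+1}h_U .\]
   Context: $E$ is a finite set partitioned as $E=E_1\sqcup\cdots\sqcup E_n$ into nonempty blocks; $S\subseteq E$ is colored if $|S\cap E_i|\le1$ for all $i$, and $\mathcal{R}_\pi^\times$ is the set of nonempty colored subsets. The $x_S$ ($S\in\mathcal{R}_\pi^\times$) are the generators of the Chow ring $A^*(\Sigma^\pi)=\mathbb{Z}[x_S]/(\mathcal{I}+\mathcal{J})$ (with $\mathcal{I}$ generated by $x_Sx_{S'}$ for incomparable $S,S'$, $\mathcal{J}$ by $\sum_{S\ni e}x_S-\sum_{S\ni e'}x_S$ for distinct $e,e'$ in a common block), and $h_S=\sum_{S'\in\mathcal{R}_\pi^\times,\,S'\cap S\neq\emptyset}x_{S'}$. -}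

module Defs where

open import Level using (Level)
open import Algebra.Bundles using (CommutativeRing)
open import Data.Nat using (ℕ; zero; suc) renaming (_+_ to _+ℕ_)
open import Data.Fin using (Fin)
open import Data.Fin.Properties using (all?) renaming (_≟_ to _≟ᶠ_)
open import Data.Fin.Subset using (Subset; _∈_; _⊆_; _∩_; Nonempty; ∣_∣; inside; outside)
open import Data.Fin.Subset.Properties using (_∈?_; _⊆?_; nonempty?)
open import Data.Vec using (Vec; []; _∷_)
open import Data.List using (List; []; _∷_; _++_; map; filter; foldr)
open import Data.Product using (_×_)
open import Relation.Nullary using (Dec; ¬_)
open import Relation.Nullary.Decidable using (_→-dec_; _×-dec_; ¬?)
open import Relation.Binary.PropositionalEquality using (_≡_)

allSubsets : (m : ℕ) → List (Subset m)
allSubsets zero = [] ∷ []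
allSubsets (suc m) = map (outside ∷_) (allSubsets m) ++ map (inside ∷_) (allSubsets m)

-- The ground set is E = Fin m; the partition into blocks E_1,…,E_n is given by
-- the block map  col : Fin m → Fin n  (e ∈ E_{col e}).
module _ {m n : ℕ} (col : Fin m → Fin n) where

  -- S is colored: |S ∩ E_i| ≤ 1 for every block, i.e. two elements of S in the same block coincide.
  Colored : Subset m → Set
  Colored S = ∀ e e' → e ∈ S → e' ∈ S → col e ≡ col e' → e ≡ e'

  colored? : (S : Subset m) → Dec (Colored S)
  colored? S = all? λ e → all? λ e' →
    (e ∈? S) →-dec (e' ∈? S) →-dec (col e ≟ᶠ col e') →-dec (e ≟ᶠ e')

  InR : Subset m → Set
  InR S = Nonempty S × Colored S

  inR? : (S : Subset m) → Dec (InR S)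
  inR? S = nonempty? S ×-dec colored? S

  Rπ× : List (Subset m)
  Rπ× = filter inR? (allSubsets m)

-- Ring-valued notions, for a commutative ring R and a family x indexed by subsets
-- (only its values on R_π^× are ever used).
module ChowNotation {c ℓ : Level} (R : CommutativeRing c ℓ) {m n : ℕ} (col : Fin m → Fin n)
                    (x : Subset m → CommutativeRing.Carrier R) where
  open CommutativeRing R

  ∑ : {A : Set} → List A → (A → Carrier) → Carrier
  ∑ xs f = foldr (λ a r → f a + r) 0# xs

  sgn : ℕ → Carrier
  sgn zero = 1#
  sgn (suc k) = - sgn k

  h : Subset m → Carrier
  h U = ∑ (filter (λ S' → nonempty? (S' ∩ U)) (Rπ× col)) x

  ∑∋ : Fin m → Carrier
  ∑∋ e = ∑ (filter (λ S → e ∈? S) (Rπ× col)) x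

  -- x satisfies the relations of the ideal I + J defining A*(Σ^π)
  RelI : Set _
  RelI = ∀ S S' → InR col S → InR col S' → ¬ (S ⊆ S') → ¬ (S' ⊆ S) → x S * x S' ≈ 0#

  RelJ : Set _
  RelJ = ∀ e e' → ¬ (e ≡ e') → col e ≡ col e' → ∑∋ e ≈ ∑∋ e'

  rhs : Subset m → Carrier
  rhs S = ∑ (filter (λ T → S ⊆? T) (Rπ× col)) λ T →
          ∑ (filter (λ U → U ⊆? T) (Rπ× col)) λ U →
          sgn (∣ T ∣ +ℕ ∣ S ∣ +ℕ ∣ U ∣ +ℕ 1) * h U

-- The identity is formal in the x_S.  Since h_U counts x_{S'} once for every S' meeting U,
-- inclusion–exclusion over the nonempty U ⊆ T gives
--   Σ_{U ⊆ T} (-1)^{|U|+1} h_U = Σ_{S' ⊇ T} x_{S'},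
-- and Möbius inversion on the Boolean lattice recovers x_S from these upper sums.
-- All subsets involved are colored because they lie inside a colored set.
module Submission where

open import Defs
open import Level using (Level)
open import Algebra.Bundles using (CommutativeRing)
open import Data.Nat using (ℕ; zero; suc) renaming (_+_ to _+ℕ_)
import Data.Nat.Properties as ℕₚ
open import Data.Fin using (Fin; zero; suc)
open import Data.Fin.Subset using (Subset; _⊆_; _∩_; Nonempty; Empty; ∣_∣; inside; outside)
open import Data.Fin.Subset.Properties using (_⊆?_; nonempty?; x∈p∩q⁻)
open import Data.Vec using (_∷_; []; here; there)
import Data.Vec.Properties as Vec
import Data.Bool as Bool
open import Data.Bool using (if_then_else_)
open import Data.List using (List; _∷_; []; _++_; map; filter; foldr)
open import Data.List.Membership.Propositional using (_∈_)
open import Data.List.Membership.Propositional.Properties using (∈-filter⁻)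
open import Data.List.Relation.Unary.Any using (here; there)
open import Data.Product using (∃; _,_; proj₁; proj₂)
open import Relation.Nullary using (Dec; yes; no; does; ¬_)
open import Relation.Nullary.Decidable using (¬?)
open import Relation.Unary using (Decidable)
open import Relation.Binary.PropositionalEquality as ≡ using (_≡_)

module Sums {c ℓ : Level} (R : CommutativeRing c ℓ) where
  open CommutativeRing R hiding (zero)
  open import Algebra.Properties.Ring ring using (-‿distribˡ-*; -‿distribʳ-*; -‿involutive; -0#≈0#; -‿+-comm)
  open import Algebra.Properties.CommutativeSemigroup +-commutativeSemigroup using (interchange)

  ∑ : {A : Set} → List A → (A → Carrier) → Carrier
  ∑ xs f = foldr (λ a r → f a + r) 0# xs

  𝟙 : {A : Set} → Dec A → Carrier
  𝟙 d = if does d then 1# else 0#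

  sgn : ℕ → Carrier
  sgn zero = 1#
  sgn (suc k) = - sgn k

  module _ {A : Set} where

    𝟙-yes : A → (a : Dec A) → 𝟙 a ≈ 1#
    𝟙-yes _ (yes _) = refl
    𝟙-yes a (no ¬a) with () ← ¬a a

    𝟙-no : ¬ A → (a : Dec A) → 𝟙 a ≈ 0#
    𝟙-no ¬a (yes a) with () ← ¬a a
    𝟙-no _ (no _) = refl

  𝟙-cong : {A B : Set} → (A → B) → (B → A) → (a : Dec A) (b : Dec B) → 𝟙 a ≈ 𝟙 b
  𝟙-cong f g (yes a) b = sym (𝟙-yes (f a) b)
  𝟙-cong f g (no ¬a) b = sym (𝟙-no (λ b → ¬a (g b)) b)

  𝟙-absorb : {A B D : Set} → (B → D → A) → (a : Dec A) (b : Dec B) (d : Dec D) (s : Carrier)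
           → 𝟙 a * (𝟙 b * (s * 𝟙 d)) ≈ 𝟙 b * (s * 𝟙 d)
  𝟙-absorb _ (yes _) b d s = *-identityˡ _
  𝟙-absorb _ (no _) (no _) d s = trans (zeroˡ _) (sym (zeroˡ _))
  𝟙-absorb _ (no _) (yes _) (no _) s = trans (zeroˡ _) (sym (trans (*-congˡ (zeroʳ s)) (zeroʳ _)))
  𝟙-absorb bd⇒a (no ¬a) (yes b) (yes d) s with () ← ¬a (bd⇒a b d)

  sgn-+ : ∀ p q → sgn (p +ℕ q) ≈ sgn p * sgn q
  sgn-+ zero q = sym (*-identityˡ _)
  sgn-+ (suc p) q = trans (-‿cong (sgn-+ p q)) (-‿distribˡ-* (sgn p) (sgn q))

  sgn-suc-+-suc : ∀ p q → sgn (suc p +ℕ suc q) ≈ sgn (p +ℕ q)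
  sgn-suc-+-suc p q rewrite ℕₚ.+-suc p q = -‿involutive _

  module _ {A : Set} where

    ∑-cong-∈ : (xs : List A) {f g : A → Carrier} → (∀ {a} → a ∈ xs → f a ≈ g a) → ∑ xs f ≈ ∑ xs g
    ∑-cong-∈ [] _ = refl
    ∑-cong-∈ (a ∷ xs) f≈g = +-cong (f≈g (here ≡.refl)) (∑-cong-∈ xs (λ a∈xs → f≈g (there a∈xs)))

    ∑-cong : (xs : List A) {f g : A → Carrier} → (∀ a → f a ≈ g a) → ∑ xs f ≈ ∑ xs g
    ∑-cong xs f≈g = ∑-cong-∈ xs (λ {a} _ → f≈g a)

    ∑-≈0 : (xs : List A) {f : A → Carrier} → (∀ a → f a ≈ 0#) → ∑ xs f ≈ 0#
    ∑-≈0 [] _ = refl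
    ∑-≈0 (a ∷ xs) f≈0 = trans (+-cong (f≈0 a) (∑-≈0 xs f≈0)) (+-identityˡ 0#)

    ∑-+ : (xs : List A) (f g : A → Carrier) → ∑ xs (λ a → f a + g a) ≈ ∑ xs f + ∑ xs g
    ∑-+ [] f g = sym (+-identityˡ 0#)
    ∑-+ (a ∷ xs) f g = trans (+-congˡ (∑-+ xs f g)) (interchange (f a) (g a) (∑ xs f) (∑ xs g))

    ∑-*ˡ : (xs : List A) (k : Carrier) (f : A → Carrier) → ∑ xs (λ a → k * f a) ≈ k * ∑ xs f
    ∑-*ˡ [] k f = sym (zeroʳ k)
    ∑-*ˡ (a ∷ xs) k f = trans (+-congˡ (∑-*ˡ xs k f)) (sym (distribˡ k (f a) (∑ xs f)))

    ∑-*ʳ : (xs : List A) (k : Carrier) (f : A → Carrier) → ∑ xs (λ a → f a * k) ≈ ∑ xs f * k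
    ∑-*ʳ xs k f = trans (∑-cong xs (λ a → *-comm (f a) k)) (trans (∑-*ˡ xs k f) (*-comm k _))

    ∑-neg : (xs : List A) (f : A → Carrier) → ∑ xs (λ a → - f a) ≈ - ∑ xs f
    ∑-neg [] f = sym -0#≈0#
    ∑-neg (a ∷ xs) f = trans (+-congˡ (∑-neg xs f)) (-‿+-comm (f a) (∑ xs f))

    ∑-++ : (xs ys : List A) (f : A → Carrier) → ∑ (xs ++ ys) f ≈ ∑ xs f + ∑ ys f
    ∑-++ [] ys f = sym (+-identityˡ _)
    ∑-++ (a ∷ xs) ys f = trans (+-congˡ (∑-++ xs ys f)) (sym (+-assoc _ _ _))

    ∑-filter : {P : A → Set} (P? : Decidable P) (xs : List A) (f : A → Carrier)
             → ∑ (filter P? xs) f ≈ ∑ xs (λ a → 𝟙 (P? a) * f a)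
    ∑-filter P? [] f = refl
    ∑-filter P? (a ∷ xs) f with P? a
    ... | yes _ = +-cong (sym (*-identityˡ (f a))) (∑-filter P? xs f)
    ... | no _ = trans (∑-filter P? xs f) (trans (sym (+-identityˡ _)) (+-congʳ (sym (zeroˡ (f a)))))

  ∑-map : {A B : Set} (g : A → B) (xs : List A) (f : B → Carrier) → ∑ (map g xs) f ≈ ∑ xs (λ a → f (g a))
  ∑-map g [] f = refl
  ∑-map g (a ∷ xs) f = +-congˡ (∑-map g xs f)

  ∑-swap : {A B : Set} (xs : List A) (ys : List B) (f : A → B → Carrier)
         → ∑ xs (λ a → ∑ ys (f a)) ≈ ∑ ys (λ b → ∑ xs (λ a → f a b))
  ∑-swap [] ys f = sym (∑-≈0 ys (λ _ → refl))
  ∑-swap (a ∷ xs) ys f = trans (+-congˡ (∑-swap xs ys f)) (sym (∑-+ ys (f a) (λ b → ∑ xs (λ a → f a b))))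

  *-neg-middle : ∀ a b d → a * (- b * d) ≈ - (a * (b * d))
  *-neg-middle a b d = trans (*-congˡ (sym (-‿distribˡ-* b d))) (sym (-‿distribʳ-* a (b * d)))

  ∑-cancel : {A : Set} (xs : List A) {f g : A → Carrier} → (∀ a → g a ≈ - f a) → ∑ xs f + ∑ xs g ≈ 0#
  ∑-cancel xs {f} g≈-f = trans (+-congˡ (trans (∑-cong xs g≈-f) (∑-neg xs f))) (-‿inverseʳ _)

_≟ˢ_ : ∀ {m} (p q : Subset m) → Dec (p ≡ q)
_≟ˢ_ = Vec.≡-dec Bool._≟_

empty? : ∀ {m} (p : Subset m) → Dec (Empty p)
empty? p = ¬? (nonempty? p)

Empty-[] : Empty []
Empty-[] (() , _)

Nonempty-outside⁻ : ∀ {m} {p : Subset m} → Nonempty (outside ∷ p) → Nonempty p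
Nonempty-outside⁻ (suc e , there e∈p) = e , e∈p

Nonempty-outside⁺ : ∀ {m} {p : Subset m} → Nonempty p → Nonempty (outside ∷ p)
Nonempty-outside⁺ (e , e∈p) = suc e , there e∈p

Nonempty-⊆ : ∀ {m} {U T : Subset m} → U ⊆ T → Nonempty U → Nonempty T
Nonempty-⊆ U⊆T (e , e∈U) = e , U⊆T e∈U

module _ {m n : ℕ} {col : Fin m → Fin n} where

  Colored-⊆ : {U T : Subset m} → U ⊆ T → Colored col T → Colored col U
  Colored-⊆ U⊆T T-colored e e' e∈U e'∈U = T-colored e e' (U⊆T e∈U) (U⊆T e'∈U)

  InR-⊆-meets : {U T : Subset m} (S' : Subset m) → InR col T → U ⊆ T → Nonempty (S' ∩ U) → InR col U
  InR-⊆-meets {U} S' (_ , T-colored) U⊆T (e , e∈S'∩U) = (e , proj₂ (x∈p∩q⁻ S' U e∈S'∩U)) , Colored-⊆ U⊆T T-colored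

  InR-between : {S T S' : Subset m} → InR col S → InR col S' → S ⊆ T → T ⊆ S' → InR col T
  InR-between (S-nonempty , _) (_ , S'-colored) S⊆T T⊆S' = Nonempty-⊆ S⊆T S-nonempty , Colored-⊆ T⊆S' S'-colored

  ∈Rπ×⇒InR : {S : Subset m} → S ∈ Rπ× col → InR col S
  ∈Rπ×⇒InR S∈R = proj₂ (∈-filter⁻ (inR? col) {xs = allSubsets m} S∈R)

module SubsetSums {c ℓ : Level} (R : CommutativeRing c ℓ) where
  open CommutativeRing R hiding (zero)
  open Sums R
  open import Algebra.Properties.Ring ring using (-‿distribʳ-*; -‿involutive)
  open import Relation.Binary.Reasoning.Setoid setoid

  𝟙-nonempty-outside : ∀ {m} (p : Subset m) → 𝟙 (nonempty? (outside ∷ p)) ≈ 𝟙 (nonempty? p)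
  𝟙-nonempty-outside p = 𝟙-cong Nonempty-outside⁻ Nonempty-outside⁺ (nonempty? (outside ∷ p)) (nonempty? p)

  𝟙-nonempty-inside : ∀ {m} (p : Subset m) → 𝟙 (nonempty? (inside ∷ p)) ≈ 1#
  𝟙-nonempty-inside p = 𝟙-yes (zero , here) (nonempty? (inside ∷ p))

  𝟙-empty-outside : ∀ {m} (p : Subset m) → 𝟙 (empty? (outside ∷ p)) ≈ 𝟙 (empty? p)
  𝟙-empty-outside p = 𝟙-cong (λ ¬ne ne → ¬ne (Nonempty-outside⁺ ne)) (λ ¬ne ne → ¬ne (Nonempty-outside⁻ ne))
                             (empty? (outside ∷ p)) (empty? p)

  𝟙-empty-inside : ∀ {m} (p : Subset m) → 𝟙 (empty? (inside ∷ p)) ≈ 0#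
  𝟙-empty-inside p = 𝟙-no (λ ¬ne → ¬ne (zero , here)) (empty? (inside ∷ p))

  𝟙-meets-outside : ∀ {m} s (p q : Subset m) → 𝟙 (nonempty? ((s ∷ p) ∩ (outside ∷ q))) ≈ 𝟙 (nonempty? (p ∩ q))
  𝟙-meets-outside outside p q = 𝟙-nonempty-outside (p ∩ q)
  𝟙-meets-outside inside p q = 𝟙-nonempty-outside (p ∩ q)

  ∑-allSubsets-suc : ∀ {m} (f : Subset (suc m) → Carrier)
    → ∑ (allSubsets (suc m)) f ≈ ∑ (allSubsets m) (λ p → f (outside ∷ p)) + ∑ (allSubsets m) (λ p → f (inside ∷ p))
  ∑-allSubsets-suc {m} f = trans (∑-++ (map (outside ∷_) (allSubsets m)) _ f)
                                 (+-cong (∑-map _ (allSubsets m) f) (∑-map _ (allSubsets m) f))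

  ∑-allSubsets-≟ : ∀ {m} (S : Subset m) (g : Subset m → Carrier)
                 → ∑ (allSubsets m) (λ S' → 𝟙 (S ≟ˢ S') * g S') ≈ g S
  ∑-allSubsets-≟ [] g = trans (+-identityʳ _) (*-identityˡ _)
  ∑-allSubsets-≟ {suc m} (outside ∷ S) g = begin
    _                                      ≈⟨ ∑-allSubsets-suc (λ S' → 𝟙 ((outside ∷ S) ≟ˢ S') * g S') ⟩
    _ + _                                  ≈⟨ +-cong (∑-allSubsets-≟ S (λ S' → g (outside ∷ S'))) (∑-≈0 (allSubsets m) (λ _ → zeroˡ _)) ⟩
    g (outside ∷ S) + 0#                   ≈⟨ +-identityʳ _ ⟩
    g (outside ∷ S)                        ∎
  ∑-allSubsets-≟ {suc m} (inside ∷ S) g = begin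
    _                                      ≈⟨ ∑-allSubsets-suc (λ S' → 𝟙 ((inside ∷ S) ≟ˢ S') * g S') ⟩
    _ + _                                  ≈⟨ +-cong (∑-≈0 (allSubsets m) (λ _ → zeroˡ _)) (∑-allSubsets-≟ S (λ S' → g (inside ∷ S'))) ⟩
    0# + g (inside ∷ S)                    ≈⟨ +-identityˡ _ ⟩
    g (inside ∷ S)                         ∎

  ∑-⊆-sgn : ∀ {m} (T : Subset m) → ∑ (allSubsets m) (λ U → 𝟙 (U ⊆? T) * sgn ∣ U ∣) ≈ 𝟙 (empty? T)
  ∑-⊆-sgn [] = trans (+-identityʳ _) (trans (*-identityˡ _) (sym (𝟙-yes Empty-[] (empty? []))))
  ∑-⊆-sgn {suc m} (outside ∷ T) = begin
    _                          ≈⟨ ∑-allSubsets-suc (λ U → 𝟙 (U ⊆? (outside ∷ T)) * sgn ∣ U ∣) ⟩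
    _ + ∑ (allSubsets m) _     ≈⟨ +-cong (∑-⊆-sgn T) (∑-≈0 (allSubsets m) (λ _ → zeroˡ _)) ⟩
    𝟙 (empty? T) + 0#          ≈⟨ +-identityʳ _ ⟩
    𝟙 (empty? T)               ≈⟨ 𝟙-empty-outside T ⟨
    𝟙 (empty? (outside ∷ T))   ∎
  ∑-⊆-sgn {suc m} (inside ∷ T) = begin
    _                          ≈⟨ ∑-allSubsets-suc (λ U → 𝟙 (U ⊆? (inside ∷ T)) * sgn ∣ U ∣) ⟩
    _                          ≈⟨ ∑-cancel (allSubsets m) (λ U → sym (-‿distribʳ-* _ _)) ⟩
    0#                         ≈⟨ 𝟙-empty-inside T ⟨
    𝟙 (empty? (inside ∷ T))    ∎

  ∑-⊆-meets-sgn : ∀ {m} (T S' : Subset m)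
    → ∑ (allSubsets m) (λ U → 𝟙 (U ⊆? T) * (sgn (suc ∣ U ∣) * 𝟙 (nonempty? (S' ∩ U)))) + 𝟙 (empty? T) ≈ 𝟙 (T ⊆? S')
  ∑-⊆-meets-sgn [] [] = trans (+-cong ∅-term (𝟙-yes Empty-[] (empty? []))) (+-identityˡ 1#)
    where
    ∅-term : 1# * (- 1# * 𝟙 (nonempty? [])) + 0# ≈ 0#
    ∅-term = trans (+-identityʳ _) (trans (*-identityˡ _) (trans (*-congˡ (𝟙-no Empty-[] (nonempty? []))) (zeroʳ _)))
  ∑-⊆-meets-sgn {suc m} (outside ∷ T) (s ∷ S') = begin
    _ + 𝟙 (empty? (outside ∷ T))
      ≈⟨ +-cong (∑-allSubsets-suc (λ U → 𝟙 (U ⊆? (outside ∷ T)) * (sgn (suc ∣ U ∣) * 𝟙 (nonempty? ((s ∷ S') ∩ U)))))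
                (𝟙-empty-outside T) ⟩
    (_ + ∑ (allSubsets m) _) + 𝟙 (empty? T)
      ≈⟨ +-congʳ (+-cong (∑-cong (allSubsets m) (λ U → *-congˡ (*-congˡ (𝟙-meets-outside s S' U))))
                         (∑-≈0 (allSubsets m) (λ _ → zeroˡ _))) ⟩
    (_ + 0#) + 𝟙 (empty? T)
      ≈⟨ +-congʳ (+-identityʳ _) ⟩
    _ + 𝟙 (empty? T)
      ≈⟨ ∑-⊆-meets-sgn T S' ⟩
    𝟙 (T ⊆? S') ∎
  ∑-⊆-meets-sgn {suc m} (inside ∷ T) (outside ∷ S') = begin
    _ + 𝟙 (empty? (inside ∷ T))
      ≈⟨ +-cong (∑-allSubsets-suc (λ U → 𝟙 (U ⊆? (inside ∷ T)) * (sgn (suc ∣ U ∣) * 𝟙 (nonempty? ((outside ∷ S') ∩ U)))))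
                (𝟙-empty-inside T) ⟩
    _ + 0#
      ≈⟨ +-identityʳ _ ⟩
    _
      ≈⟨ +-cong (∑-cong (allSubsets m) (λ U → *-congˡ (*-congˡ (𝟙-nonempty-outside (S' ∩ U)))))
                (∑-cong (allSubsets m) (λ U → *-congˡ (*-congˡ (𝟙-nonempty-outside (S' ∩ U))))) ⟩
    _
      ≈⟨ ∑-cancel (allSubsets m) (λ U → *-neg-middle _ _ _) ⟩
    0# ∎
  ∑-⊆-meets-sgn {suc m} (inside ∷ T) (inside ∷ S') = begin
    _ + 𝟙 (empty? (inside ∷ T))
      ≈⟨ +-cong (∑-allSubsets-suc (λ U → 𝟙 (U ⊆? (inside ∷ T)) * (sgn (suc ∣ U ∣) * 𝟙 (nonempty? ((inside ∷ S') ∩ U)))))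
                (𝟙-empty-inside T) ⟩
    (_ + _) + 0#
      ≈⟨ +-identityʳ _ ⟩
    _ + _
      ≈⟨ +-cong (∑-cong (allSubsets m) (λ U → *-congˡ (*-congˡ (𝟙-nonempty-outside (S' ∩ U)))))
                (trans (∑-cong (allSubsets m) (λ U → *-congˡ (trans (*-cong (-‿involutive _) (𝟙-nonempty-inside (S' ∩ U)))
                                                                     (*-identityʳ _))))
                       (∑-⊆-sgn T)) ⟩
    _ + 𝟙 (empty? T)
      ≈⟨ ∑-⊆-meets-sgn T S' ⟩
    𝟙 (T ⊆? S') ∎

  -- μ(A, T) = (-1)^(|T|+|A|) is the Möbius function of the Boolean lattice.
  ∑-⊆⊆-sgn : ∀ {m} (A B : Subset m)
    → ∑ (allSubsets m) (λ T → 𝟙 (A ⊆? T) * (sgn (∣ T ∣ +ℕ ∣ A ∣) * 𝟙 (T ⊆? B))) ≈ 𝟙 (A ≟ˢ B)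
  ∑-⊆⊆-sgn [] [] = trans (+-identityʳ _) (trans (*-identityˡ _) (*-identityˡ _))
  ∑-⊆⊆-sgn {suc m} (outside ∷ A) (outside ∷ B) = begin
    _                      ≈⟨ ∑-allSubsets-suc (λ T → 𝟙 ((outside ∷ A) ⊆? T) * (sgn (∣ T ∣ +ℕ ∣ A ∣) * 𝟙 (T ⊆? (outside ∷ B)))) ⟩
    _ + _                  ≈⟨ +-cong (∑-⊆⊆-sgn A B) (∑-≈0 (allSubsets m) (λ _ → trans (*-congˡ (zeroʳ _)) (zeroʳ _))) ⟩
    𝟙 (A ≟ˢ B) + 0#        ≈⟨ +-identityʳ _ ⟩
    𝟙 (A ≟ˢ B)             ∎
  ∑-⊆⊆-sgn {suc m} (outside ∷ A) (inside ∷ B) = begin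
    _                      ≈⟨ ∑-allSubsets-suc (λ T → 𝟙 ((outside ∷ A) ⊆? T) * (sgn (∣ T ∣ +ℕ ∣ A ∣) * 𝟙 (T ⊆? (inside ∷ B)))) ⟩
    _                      ≈⟨ ∑-cancel (allSubsets m) (λ T → *-neg-middle _ _ _) ⟩
    0#                     ∎
  ∑-⊆⊆-sgn {suc m} (inside ∷ A) (outside ∷ B) = begin
    _                      ≈⟨ ∑-allSubsets-suc (λ T → 𝟙 ((inside ∷ A) ⊆? T) * (sgn (∣ T ∣ +ℕ suc ∣ A ∣) * 𝟙 (T ⊆? (outside ∷ B)))) ⟩
    _                      ≈⟨ +-cong (∑-≈0 (allSubsets m) (λ _ → zeroˡ _)) (∑-≈0 (allSubsets m) (λ _ → trans (*-congˡ (zeroʳ _)) (zeroʳ _))) ⟩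
    0# + 0#                ≈⟨ +-identityˡ 0# ⟩
    0#                     ∎
  ∑-⊆⊆-sgn {suc m} (inside ∷ A) (inside ∷ B) = begin
    _                      ≈⟨ ∑-allSubsets-suc (λ T → 𝟙 ((inside ∷ A) ⊆? T) * (sgn (∣ T ∣ +ℕ suc ∣ A ∣) * 𝟙 (T ⊆? (inside ∷ B)))) ⟩
    _ + _                  ≈⟨ +-cong (∑-≈0 (allSubsets m) (λ _ → zeroˡ _))
                                     (∑-cong (allSubsets m) (λ T → *-congˡ (*-congʳ (sgn-suc-+-suc ∣ T ∣ ∣ A ∣)))) ⟩
    0# + _                 ≈⟨ +-identityˡ _ ⟩
    _                      ≈⟨ ∑-⊆⊆-sgn A B ⟩
    𝟙 (A ≟ˢ B)             ∎

module _ {c ℓ : Level} (R : CommutativeRing c ℓ) {m n : ℕ} (col : Fin m → Fin n)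
         (x : Subset m → CommutativeRing.Carrier R) where
  open CommutativeRing R hiding (zero)
  open Sums R
  open SubsetSums R
  open ChowNotation R col x using (h; rhs) renaming (sgn to sgnᶜ)
  open import Algebra.Properties.CommutativeSemigroup *-commutativeSemigroup using (x∙yz≈y∙xz)
  open import Relation.Binary.Reasoning.Setoid setoid

  private
    ℛ : List (Subset m)
    ℛ = Rπ× col

  ∑⊇ : Subset m → Carrier
  ∑⊇ T = ∑ (filter (λ S' → T ⊆? S') ℛ) x

  ∑-Rπ×-≟ : {S : Subset m} → InR col S → (g : Subset m → Carrier) → ∑ ℛ (λ S' → 𝟙 (S ≟ˢ S') * g S') ≈ g S
  ∑-Rπ×-≟ {S} S∈R g = begin
    _   ≈⟨ ∑-filter (inR? col) (allSubsets m) _ ⟩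
    _   ≈⟨ ∑-cong (allSubsets m) (λ S' → x∙yz≈y∙xz _ _ _) ⟩
    _   ≈⟨ ∑-allSubsets-≟ S (λ S' → 𝟙 (inR? col S') * g S') ⟩
    𝟙 (inR? col S) * g S  ≈⟨ *-congʳ (𝟙-yes S∈R (inR? col S)) ⟩
    1# * g S              ≈⟨ *-identityˡ _ ⟩
    g S                   ∎

  ∑-⊆-meets-sgn-Rπ× : {T : Subset m} → InR col T → (S' : Subset m)
    → ∑ (filter (λ U → U ⊆? T) ℛ) (λ U → sgn (suc ∣ U ∣) * 𝟙 (nonempty? (S' ∩ U))) ≈ 𝟙 (T ⊆? S')
  ∑-⊆-meets-sgn-Rπ× {T} T∈R@(T-nonempty , _) S' = begin
    _  ≈⟨ ∑-filter (λ U → U ⊆? T) ℛ _ ⟩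
    _  ≈⟨ ∑-filter (inR? col) (allSubsets m) _ ⟩
    _  ≈⟨ ∑-cong (allSubsets m) (λ U → 𝟙-absorb {B = U ⊆ T} (InR-⊆-meets S' T∈R)
                                        (inR? col U) (U ⊆? T) (nonempty? (S' ∩ U)) _) ⟩
    _  ≈⟨ +-identityʳ _ ⟨
    _  ≈⟨ +-congˡ (𝟙-no (λ T-empty → T-empty T-nonempty) (empty? T)) ⟨
    _  ≈⟨ ∑-⊆-meets-sgn T S' ⟩
    𝟙 (T ⊆? S') ∎

  ∑-⊆-sgn-h : {T : Subset m} → InR col T
    → ∑ (filter (λ U → U ⊆? T) ℛ) (λ U → sgn (suc ∣ U ∣) * h U) ≈ ∑⊇ T
  ∑-⊆-sgn-h {T} T∈R = begin
    ∑ ℛT (λ U → sgn (suc ∣ U ∣) * h U)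
      ≈⟨ ∑-cong ℛT (λ U → *-congˡ (∑-filter (λ S' → nonempty? (S' ∩ U)) ℛ x)) ⟩
    ∑ ℛT (λ U → sgn (suc ∣ U ∣) * ∑ ℛ (λ S' → 𝟙 (nonempty? (S' ∩ U)) * x S'))
      ≈⟨ ∑-cong ℛT (λ U → sym (∑-*ˡ ℛ _ _)) ⟩
    ∑ ℛT (λ U → ∑ ℛ (λ S' → sgn (suc ∣ U ∣) * (𝟙 (nonempty? (S' ∩ U)) * x S')))
      ≈⟨ ∑-swap ℛT ℛ _ ⟩
    ∑ ℛ (λ S' → ∑ ℛT (λ U → sgn (suc ∣ U ∣) * (𝟙 (nonempty? (S' ∩ U)) * x S')))
      ≈⟨ ∑-cong ℛ (λ S' → trans (∑-cong ℛT (λ U → sym (*-assoc _ _ _))) (∑-*ʳ ℛT (x S') _)) ⟩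
    ∑ ℛ (λ S' → ∑ ℛT (λ U → sgn (suc ∣ U ∣) * 𝟙 (nonempty? (S' ∩ U))) * x S')
      ≈⟨ ∑-cong ℛ (λ S' → *-congʳ (∑-⊆-meets-sgn-Rπ× T∈R S')) ⟩
    ∑ ℛ (λ S' → 𝟙 (T ⊆? S') * x S')
      ≈⟨ ∑-filter (λ S' → T ⊆? S') ℛ x ⟨
    ∑⊇ T ∎
    where
    ℛT = filter (λ U → U ⊆? T) ℛ

  ∑-⊆⊆-sgn-Rπ× : {S S' : Subset m} → InR col S → InR col S'
    → ∑ (filter (λ T → S ⊆? T) ℛ) (λ T → sgn (∣ T ∣ +ℕ ∣ S ∣) * 𝟙 (T ⊆? S')) ≈ 𝟙 (S ≟ˢ S')
  ∑-⊆⊆-sgn-Rπ× {S} {S'} S∈R S'∈R = begin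
    _  ≈⟨ ∑-filter (λ T → S ⊆? T) ℛ _ ⟩
    _  ≈⟨ ∑-filter (inR? col) (allSubsets m) _ ⟩
    _  ≈⟨ ∑-cong (allSubsets m) (λ T → 𝟙-absorb {B = S ⊆ T} {D = T ⊆ S'} (InR-between S∈R S'∈R)
                                        (inR? col T) (S ⊆? T) (T ⊆? S') _) ⟩
    _  ≈⟨ ∑-⊆⊆-sgn S S' ⟩
    𝟙 (S ≟ˢ S') ∎

  ∑⊇-inversion : {S : Subset m} → InR col S
    → ∑ (filter (λ T → S ⊆? T) ℛ) (λ T → sgn (∣ T ∣ +ℕ ∣ S ∣) * ∑⊇ T) ≈ x S
  ∑⊇-inversion {S} S∈R = begin
    ∑ ℛS (λ T → ε T * ∑⊇ T)
      ≈⟨ ∑-cong ℛS (λ T → *-congˡ (∑-filter (λ S' → T ⊆? S') ℛ x)) ⟩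
    ∑ ℛS (λ T → ε T * ∑ ℛ (λ S' → 𝟙 (T ⊆? S') * x S'))
      ≈⟨ ∑-cong ℛS (λ T → sym (∑-*ˡ ℛ _ _)) ⟩
    ∑ ℛS (λ T → ∑ ℛ (λ S' → ε T * (𝟙 (T ⊆? S') * x S')))
      ≈⟨ ∑-swap ℛS ℛ _ ⟩
    ∑ ℛ (λ S' → ∑ ℛS (λ T → ε T * (𝟙 (T ⊆? S') * x S')))
      ≈⟨ ∑-cong ℛ (λ S' → trans (∑-cong ℛS (λ T → sym (*-assoc _ _ _))) (∑-*ʳ ℛS (x S') _)) ⟩
    ∑ ℛ (λ S' → ∑ ℛS (λ T → ε T * 𝟙 (T ⊆? S')) * x S')
      ≈⟨ ∑-cong-∈ ℛ (λ S'∈ℛ → *-congʳ (∑-⊆⊆-sgn-Rπ× S∈R (∈Rπ×⇒InR S'∈ℛ))) ⟩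
    ∑ ℛ (λ S' → 𝟙 (S ≟ˢ S') * x S')
      ≈⟨ ∑-Rπ×-≟ S∈R x ⟩
    x S ∎
    where
    ℛS = filter (λ T → S ⊆? T) ℛ
    ε : Subset m → Carrier
    ε T = sgn (∣ T ∣ +ℕ ∣ S ∣)

  sgnᶜ≈sgn : ∀ k → sgnᶜ k ≈ sgn k
  sgnᶜ≈sgn zero = refl
  sgnᶜ≈sgn (suc k) = -‿cong (sgnᶜ≈sgn k)

  rhs≈∑-sgn-∑-sgn-h : (S : Subset m) → rhs S ≈
    ∑ (filter (λ T → S ⊆? T) ℛ) (λ T → sgn (∣ T ∣ +ℕ ∣ S ∣) *
      ∑ (filter (λ U → U ⊆? T) ℛ) (λ U → sgn (suc ∣ U ∣) * h U))
  rhs≈∑-sgn-∑-sgn-h S = ∑-cong (filter (λ T → S ⊆? T) ℛ) λ T →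
    trans (∑-cong (filter (λ U → U ⊆? T) ℛ) (λ U → trans (*-congʳ (sgn-split (∣ T ∣ +ℕ ∣ S ∣) ∣ U ∣)) (*-assoc _ _ _)))
          (∑-*ˡ (filter (λ U → U ⊆? T) ℛ) _ _)
    where
    sgn-split : ∀ a u → sgnᶜ (a +ℕ u +ℕ 1) ≈ sgn a * sgn (suc u)
    sgn-split a u = trans (sgnᶜ≈sgn (a +ℕ u +ℕ 1))
      (trans (reflexive (≡.cong sgn (≡.trans (ℕₚ.+-assoc a u 1) (≡.cong (a +ℕ_) (ℕₚ.+-comm u 1)))))
             (sgn-+ a (suc u)))

lemma2p8 : {c ℓ : Level} (R : CommutativeRing c ℓ) (m n : ℕ) (col : Fin m → Fin n)
    → (∀ i → ∃ λ e → col e ≡ i)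
    → (x : Subset m → CommutativeRing.Carrier R)
    → ChowNotation.RelI R col x
    → ChowNotation.RelJ R col x
    → ∀ S → InR col S
    → CommutativeRing._≈_ R (x S) (ChowNotation.rhs R col x S)
lemma2p8 R m n col _ x _ _ S S∈R = sym (begin
  rhs S
    ≈⟨ rhs≈∑-sgn-∑-sgn-h R col x S ⟩
  ∑ ℛS (λ T → sgn (∣ T ∣ +ℕ ∣ S ∣) * ∑ (filter (λ U → U ⊆? T) (Rπ× col)) (λ U → sgn (suc ∣ U ∣) * h U))
    ≈⟨ ∑-cong-∈ ℛS (λ T∈ℛS → *-congˡ (∑-⊆-sgn-h R col x (∈Rπ×⇒InR (proj₁ (∈-filter⁻ (λ T → S ⊆? T) T∈ℛS))))) ⟩
  ∑ ℛS (λ T → sgn (∣ T ∣ +ℕ ∣ S ∣) * ∑⊇ R col x T)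
    ≈⟨ ∑⊇-inversion R col x S∈R ⟩
  x S ∎)
  where
  open CommutativeRing R
  open Sums R
  open ChowNotation R col x using (h; rhs)
  open import Relation.Binary.Reasoning.Setoid setoid
  ℛS = filter (λ T → S ⊆? T) (Rπ× col)
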